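{- Let $\lambda$ be a JS-partition of type $\alpha\in\{0,\dots,p-1\}$ with $l$ parts, and let $r\in\{0,\dots,p-1\}$ with $l\equiv r\pmod p$. Then the $p$-core of $\lambda$ is $$\lambda_{(p)}=\begin{cases}((\alpha+s)^s)\ \text{with } s=r & \text{if } r\le\frac{p-\alpha}{2},\\ ((\alpha+s)^s)\ \text{with } s=(p-\alpha)-r & \text{if } \frac{p-\alpha}{2}<r\le p-\alpha,\\ (s^{p-\alpha+s})\ \text{with } s=r-(p-\alpha) & \text{if } p-\alpha<r\le p-\frac{\alpha}{2},\\ (s^{p-\alpha+s})\ \text{with } s=p-r & \text{if } p-\frac{\alpha}{2}<r<p,\end{cases}$$ where $(c^0)$ and $(0^b)$ denote the empty partition.
   Context: Fix an integer $p\ge 2$. A partition is written $\lambda=(l_1^{a_1},\dots,l_t^{a_t})$ with $l_1>\dots>l_t>0$, $a_i\ge1$; $(c^b)$ denotes the partition with $b$ parts all equal to $c$. It is $p$-regular if all $a_i\le p-1$. A $p$-regular $\lambda$ is a JS-partition if $l_i-l_{i+1}+a_i+a_{i+1}\equiv 0\pmod p$ for $1\le i<t$; its type is $l_1-a_1 \bmod p$. The $p$-core $\lambda_{(p)}$ is obtained from $\lambda$ by repeatedly removing rim hooks of length $p$ until none remains. -}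

module Defs where

open import Data.Nat using (ℕ; zero; suc; _+_; _*_; _∸_; _≤_; _<_; _<ᵇ_; NonZero)
open import Data.Nat.DivMod using (_%_)
open import Data.Nat.Divisibility using (_∣_)
open import Data.Bool using (if_then_else_; _∨_)
open import Data.List using (List; []; _∷_; length; replicate; concatMap)
open import Data.List.Relation.Unary.All using (All)
open import Data.List.Relation.Unary.Linked using (Linked)
open import Data.Product using (_×_; _,_; ∃-syntax)
open import Relation.Nullary using (¬_)
open import Relation.Binary.PropositionalEquality using (_≡_)
open import Relation.Binary.Construct.Closure.ReflexiveTransitive using (Star)

Partition : Set
Partition = List ℕ

IsPartition : Partition → Set
IsPartition μ = All (λ x → 0 < x) μ × Linked (λ x y → y ≤ x) μ

-- k-th part (0-indexed), with the convention that parts beyond the length are 0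
part : Partition → ℕ → ℕ
part []       k       = 0
part (x ∷ _)  zero    = x
part (_ ∷ xs) (suc k) = part xs k

-- (c^b): b parts all equal to c; (c^0) and (0^b) are the empty partition
rect : ℕ → ℕ → Partition
rect zero    b = []
rect (suc c) b = replicate b (suc c)

-- A rim hook of λ occupying rows i..j (0-indexed, i ≤ j < length λ) and
-- leaving c cells in row j is the connected border strip (no 2×2 square)
-- consisting, for i ≤ k < j, of the cells of row k in columns
-- λ_{k+1},…,λ_k (1-indexed columns), and of the cells of row j in columns
-- c+1,…,λ_j.

hookRemoved : Partition → ℕ → ℕ → ℕ → ℕ → ℕ
hookRemoved λp i j c k =
  if (k <ᵇ i) ∨ (j <ᵇ k) then part λp k
  else if k <ᵇ j then part λp (suc k) ∸ 1
  else c

RemoveRimHook : ℕ → Partition → Partition → Set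
RemoveRimHook p λp μ =
  ∃[ i ] ∃[ j ] ∃[ c ]
    ( i ≤ j × j < length λp
    × c < part λp j × part λp (suc j) ≤ c
    × (part λp i ∸ c) + (j ∸ i) ≡ p
    × IsPartition μ
    × (∀ k → part μ k ≡ hookRemoved λp i j c k) )

IsPCoreOf : ℕ → Partition → Partition → Set
IsPCoreOf p λp μ = Star (RemoveRimHook p) λp μ × (∀ ν → ¬ RemoveRimHook p μ ν)

-- Partitions in exponential notation (l_1^{a_1},…,l_t^{a_t}) given as the
-- list of pairs (l_i , a_i).

Blocks : Set
Blocks = List (ℕ × ℕ)

toPartition : Blocks → Partition
toPartition = concatMap (λ { (l , a) → replicate a l })

data NonEmpty {A : Set} : List A → Set where
  nonEmpty : ∀ x xs → NonEmpty (x ∷ xs)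

IsJSBlocks : ℕ → Blocks → Set
IsJSBlocks p bs =
  NonEmpty bs
  × All (λ { (l , a) → 0 < l × 1 ≤ a × a < p }) bs
  × Linked (λ { (l , a) (l′ , a′) → l′ < l × p ∣ ((l ∸ l′) + a + a′) }) bs

-- type of a JS-partition: l_1 − a_1 mod p  (computed as (l_1 + p − a_1) mod p,
-- which is the same residue since a_1 ≤ p)
jsType : (p : ℕ) → .{{NonZero p}} → Blocks → ℕ
jsType p []            = 0
jsType p ((l , a) ∷ _) = ((l + p) ∸ a) % p

{-# OPTIONS --safe #-}
-- Encode a partition by its β-set, one bead per part, on an abacus with p runners:
-- removing a rim hook of length p is sliding a bead from position t + p down to a vacant
-- position t.  Take the blocks of the JS-partition from the smallest parts upwards.  The beads
-- already processed always settle into two runs, at 0, …, z − 1 and at w, …, w + b − 1 with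
-- (w − z) + b ≤ p; they encode the rectangle ((w − z)^b), which has no hook of length p.  The JS
-- congruence l_i − l_{i+1} + a_i + a_{i+1} ≡ 0 says exactly that the top bead of the next block
-- slides down onto the slot just below the upper run, and so does each following bead of the
-- block.  Throughout, z or w + b is a multiple of p; with z + b = ℓ(λ) ≡ r and w ≡ α + r this
-- pins down (w − z, b) and yields the four cases.
module Submission where

open import Data.Bool using (if_then_else_; _∨_)
open import Data.Empty using (⊥-elim)
open import Data.List using (List; []; _∷_; _++_; length; replicate; applyDownFrom; downFrom)
open import Data.List.Properties using (length-++; ++-assoc; ++-identityʳ; length-applyDownFrom; length-downFrom; length-replicate)
open import Data.List.Relation.Unary.All using (All; []; _∷_)
import Data.List.Relation.Unary.All as All
import Data.List.Relation.Unary.All.Properties as All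
open import Data.List.Relation.Unary.AllPairs using (AllPairs; []; _∷_)
import Data.List.Relation.Unary.AllPairs.Properties as AllPairs
open import Data.List.Relation.Unary.Linked using (Linked; []; [-]; _∷_)
import Data.List.Relation.Unary.Linked as Linked
open import Data.Nat
open import Data.Nat.DivMod using (_%_; _/_; m≡m%n+[m/n]*n; m%n<n)
open import Data.Nat.Divisibility using (_∣_; divides)
open import Data.Nat.Properties
open import Data.Nat.Solver using (module +-*-Solver)
open import Data.Product using (∃-syntax; ∃₂; _×_; _,_; proj₁; proj₂)
open import Data.Sum using (_⊎_; inj₁; inj₂; [_,_]′; map₂)
open import Level using (0ℓ)
open import Relation.Binary.Bundles using (Setoid)
open import Relation.Binary.Construct.Closure.ReflexiveTransitive using (Star; ε; _◅_; _◅◅_)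
import Relation.Binary.Construct.Closure.ReflexiveTransitive as Star
open import Relation.Binary.Definitions using (tri<; tri≈; tri>)
open import Relation.Binary.PropositionalEquality
import Relation.Binary.Reasoning.Setoid as SetoidReasoning
open import Relation.Binary.Structures using (IsEquivalence)
open import Relation.Nullary using (¬_; yes; no)
open +-*-Solver using (solve; _:+_; _:*_; _:=_; con)

open import Defs

infix 4 _≡_mod_
_≡_mod_ : ℕ → ℕ → ℕ → Set
_≡_mod_ a b p = ∃₂ λ u v → a + u * p ≡ b + v * p

module _ {p : ℕ} where

  ≡-mod-reflexive : ∀ {a b} → a ≡ b → a ≡ b mod p
  ≡-mod-reflexive {a} refl = 0 , 0 , refl

  ≡-mod-refl : ∀ {a} → a ≡ a mod p
  ≡-mod-refl = ≡-mod-reflexive refl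

  ≡-mod-sym : ∀ {a b} → a ≡ b mod p → b ≡ a mod p
  ≡-mod-sym (u , v , e) = v , u , sym e

  ≡-mod-trans : ∀ {a b c} → a ≡ b mod p → b ≡ c mod p → a ≡ c mod p
  ≡-mod-trans {a} {b} {c} (u , v , e) (u′ , v′ , e′) = u + u′ , v′ + v , (begin
    a + (u + u′) * p       ≡⟨ solve 4 (λ a u u′ p → a :+ (u :+ u′) :* p := (a :+ u :* p) :+ u′ :* p) refl a u u′ p ⟩
    (a + u * p) + u′ * p   ≡⟨ cong (_+ u′ * p) e ⟩
    (b + v * p) + u′ * p   ≡⟨ solve 4 (λ b v u′ p → (b :+ v :* p) :+ u′ :* p := (b :+ u′ :* p) :+ v :* p) refl b v u′ p ⟩
    (b + u′ * p) + v * p   ≡⟨ cong (_+ v * p) e′ ⟩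
    (c + v′ * p) + v * p   ≡⟨ solve 4 (λ c v′ v p → (c :+ v′ :* p) :+ v :* p := c :+ (v′ :+ v) :* p) refl c v′ v p ⟩
    c + (v′ + v) * p       ∎)
    where open ≡-Reasoning

  +-≡-mod : ∀ {a b c d} → a ≡ b mod p → c ≡ d mod p → a + c ≡ b + d mod p
  +-≡-mod {a} {b} {c} {d} (u , v , e) (u′ , v′ , e′) = u + u′ , v + v′ , (begin
    a + c + (u + u′) * p         ≡⟨ solve 5 (λ a c u u′ p → a :+ c :+ (u :+ u′) :* p := (a :+ u :* p) :+ (c :+ u′ :* p)) refl a c u u′ p ⟩
    (a + u * p) + (c + u′ * p)   ≡⟨ cong₂ _+_ e e′ ⟩
    (b + v * p) + (d + v′ * p)   ≡⟨ solve 5 (λ b d v v′ p → (b :+ v :* p) :+ (d :+ v′ :* p) := b :+ d :+ (v :+ v′) :* p) refl b d v v′ p ⟩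
    b + d + (v + v′) * p         ∎)
    where open ≡-Reasoning

  +-cancelʳ-≡-mod : ∀ {a b} c → a + c ≡ b + c mod p → a ≡ b mod p
  +-cancelʳ-≡-mod {a} {b} c (u , v , e) = u , v , +-cancelʳ-≡ c _ _ (begin
    a + u * p + c   ≡⟨ solve 4 (λ a u p c → a :+ u :* p :+ c := a :+ c :+ u :* p) refl a u p c ⟩
    a + c + u * p   ≡⟨ e ⟩
    b + c + v * p   ≡⟨ solve 4 (λ b v p c → b :+ c :+ v :* p := b :+ v :* p :+ c) refl b v p c ⟩
    b + v * p + c   ∎)
    where open ≡-Reasoning

  +-cancelˡ-≡-mod : ∀ c {a b} → c + a ≡ c + b mod p → a ≡ b mod p
  +-cancelˡ-≡-mod c {a} {b} h =
    +-cancelʳ-≡-mod c (subst₂ (λ x y → x ≡ y mod p) (+-comm c a) (+-comm c b) h)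

  m+p≡m-mod : ∀ a → a + p ≡ a mod p
  m+p≡m-mod a = 0 , 1 , solve 2 (λ a p → a :+ p :+ con 0 :* p := a :+ con 1 :* p) refl a p

  ≡-mod-≤⇒∃ : ∀ {a b} → a ≡ b mod p → b ≤ a → ∃[ k ] a ≡ b + k * p
  ≡-mod-≤⇒∃ {a} {b} (u , v , e) b≤a with ≤-total u v
  ... | inj₁ u≤v = v ∸ u , +-cancelʳ-≡ (u * p) a (b + (v ∸ u) * p) (begin
    a + u * p                 ≡⟨ e ⟩
    b + v * p                 ≡⟨ cong (λ x → b + x * p) (sym (m∸n+n≡m u≤v)) ⟩
    b + (v ∸ u + u) * p       ≡⟨ solve 4 (λ b d u p → b :+ (d :+ u) :* p := b :+ d :* p :+ u :* p) refl b (v ∸ u) u p ⟩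
    b + (v ∸ u) * p + u * p   ∎)
    where open ≡-Reasoning
  ... | inj₂ v≤u = 0 , trans (≤-antisym a≤b b≤a) (sym (+-identityʳ b))
    where
    a≤b : a ≤ b
    a≤b = +-cancelʳ-≤ (v * p) a b (≤-trans (+-monoʳ-≤ a (*-monoˡ-≤ p v≤u)) (≤-reflexive e))

  ≡-mod-<⇒+p≤ : ∀ {a b} → a ≡ b mod p → b < a → b + p ≤ a
  ≡-mod-<⇒+p≤ {a} {b} e b<a with ≡-mod-≤⇒∃ e (<⇒≤ b<a)
  ... | zero  , a≡b+0 = ⊥-elim (<-irrefl (sym (trans a≡b+0 (+-identityʳ b))) b<a)
  ... | suc k , a≡b+p+kp = subst (b + p ≤_) (sym a≡b+p+kp) (+-monoʳ-≤ b (m≤m+n p (k * p)))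

  ≡-mod-<p⇒≡ : ∀ {a b} → a ≡ b mod p → a < p → b < p → a ≡ b
  ≡-mod-<p⇒≡ {a} {b} e a<p b<p with <-cmp a b
  ... | tri< a<b _ _ = ⊥-elim (<⇒≱ b<p (≤-trans (m≤n+m p a) (≡-mod-<⇒+p≤ (≡-mod-sym e) a<b)))
  ... | tri≈ _ a≡b _ = a≡b
  ... | tri> _ _ b<a = ⊥-elim (<⇒≱ a<p (≤-trans (m≤n+m p b) (≡-mod-<⇒+p≤ e b<a)))

  ≡-mod-≤p⇒≡ : ∀ {a b} → a ≡ b mod p → 0 < a → a ≤ p → 0 < b → b ≤ p → a ≡ b
  ≡-mod-≤p⇒≡ {suc a} {suc b} e _ a<p _ b<p = cong suc (≡-mod-<p⇒≡ (+-cancelˡ-≡-mod 1 e) a<p b<p)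

  n≡0-mod : ∀ {n} → p ∣ n → n ≡ 0 mod p
  n≡0-mod {n} (divides q n≡q*p) = 0 , q , trans (+-identityʳ n) n≡q*p

  ≡-mod-isEquivalence : IsEquivalence (λ a b → a ≡ b mod p)
  ≡-mod-isEquivalence = record { refl = ≡-mod-refl ; sym = ≡-mod-sym ; trans = ≡-mod-trans }

≡-mod-setoid : ℕ → Setoid 0ℓ 0ℓ
≡-mod-setoid p = record { Carrier = ℕ ; _≈_ = λ a b → a ≡ b mod p ; isEquivalence = ≡-mod-isEquivalence }

module ≡-mod-Reasoning (p : ℕ) = SetoidReasoning (≡-mod-setoid p)

module _ {p : ℕ} .{{_ : NonZero p}} where
  open ≡-mod-Reasoning p

  %-≡-mod : ∀ a → a % p ≡ a mod p
  %-≡-mod a = a / p , 0 , trans (sym (m≡m%n+[m/n]*n a p)) (sym (+-identityʳ a))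

  %≡%⇒≡-mod : ∀ {a b} → a % p ≡ b % p → a ≡ b mod p
  %≡%⇒≡-mod {a} {b} a%p≡b%p = begin
    a       ≈⟨ %-≡-mod a ⟨
    a % p   ≡⟨ a%p≡b%p ⟩
    b % p   ≈⟨ %-≡-mod b ⟩
    b       ∎

  positive-residue : ∀ x → ∃[ w ] 0 < w × w ≤ p × w ≡ x mod p
  positive-residue x = suc (y % p) , z<s , m%n<n y p , (begin
    suc (y % p)   ≈⟨ +-≡-mod {a = 1} ≡-mod-refl (%-≡-mod y) ⟩
    suc y         ≡⟨ x+p≡1+y ⟨
    x + p         ≈⟨ m+p≡m-mod x ⟩
    x             ∎)
    where
    y : ℕ
    y = x + (p ∸ 1)
    x+p≡1+y : x + p ≡ suc y
    x+p≡1+y = trans (cong (x +_) (sym (suc-pred p))) (+-suc x (p ∸ 1))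

Sorted : List ℕ → Set
Sorted = AllPairs _>_

Sorted-++⁻ : ∀ xs {ys} → Sorted (xs ++ ys) → Sorted xs × Sorted ys × All (λ x → All (x >_) ys) xs
Sorted-++⁻ []       s         = [] , s , []
Sorted-++⁻ (x ∷ xs) (x>xs++ys ∷ s) with Sorted-++⁻ xs s
... | sxs , sys , xs>ys = All.++⁻ˡ xs x>xs++ys ∷ sxs , sys , All.++⁻ʳ xs x>xs++ys ∷ xs>ys

length-below : ∀ {xs m} → Sorted xs → All (_< m) xs → length xs ≤ m
length-below []         []        = z≤n
length-below (x>xs ∷ s) (x<m ∷ _) = ≤-trans (s≤s (length-below s x>xs)) x<m

length-between : ∀ {xs lo hi} → Sorted xs → All (lo <_) xs → All (_< hi) xs → lo ≤ hi → length xs + lo ≤ hi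
length-between []         []             []         lo≤hi = lo≤hi
length-between (x>xs ∷ s) (lo<x ∷ lo<xs) (x<hi ∷ _) _     = ≤-trans (s≤s (length-between s lo<xs x>xs (<⇒≤ lo<x))) x<hi

-- A strictly decreasing list B of bead positions (a β-set) encodes the partition whose
-- k-th part is the k-th bead minus the number of beads after it; `rows` lists these
-- numbers, `fromβ` drops the trailing zeros.
rows : List ℕ → List ℕ
rows []       = []
rows (x ∷ xs) = x ∸ length xs ∷ rows xs

fromβ : List ℕ → Partition
fromβ []       = []
fromβ (x ∷ xs) with length xs <? x
... | yes _ = x ∸ length xs ∷ fromβ xs
... | no  _ = []

rows-vanish : ∀ {x xs} → Sorted (x ∷ xs) → x ≤ length xs → ∀ k → part (rows (x ∷ xs)) k ≡ 0
rows-vanish               _               x≤n zero    = m≤n⇒m∸n≡0 x≤n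
rows-vanish {xs = []}     _               _   (suc k) = refl
rows-vanish {xs = y ∷ ys} ((y<x ∷ _) ∷ s) x≤n (suc k) = rows-vanish s (≤-pred (≤-trans y<x x≤n)) k

part-fromβ : ∀ {B} → Sorted B → ∀ k → part (fromβ B) k ≡ part (rows B) k
part-fromβ {[]}     _ k = refl
part-fromβ {x ∷ xs} s k with length xs <? x
part-fromβ {x ∷ xs} s           zero    | yes _   = refl
part-fromβ {x ∷ xs} (_ ∷ s)     (suc k) | yes _   = part-fromβ s k
part-fromβ {x ∷ xs} s           k       | no n≮x  = sym (rows-vanish s (≮⇒≥ n≮x) k)

fromβ-positive : ∀ B → All (0 <_) (fromβ B)
fromβ-positive []       = []
fromβ-positive (x ∷ xs) with length xs <? x
... | yes n<x = m<n⇒0<n∸m n<x ∷ fromβ-positive xs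
... | no  _   = []

fromβ-decreasing : ∀ {B} → Sorted B → Linked (λ x y → y ≤ x) (fromβ B)
fromβ-decreasing {[]}         _ = []
fromβ-decreasing {x ∷ []}     _ with 0 <? x
... | yes _ = [-]
... | no  _ = []
fromβ-decreasing {x ∷ y ∷ ys} ((y<x ∷ _) ∷ s) with suc (length ys) <? x
... | no  _ = []
... | yes _ with length ys <? y | fromβ-decreasing s
...   | yes _ | ih = ∸-monoˡ-≤ (suc (length ys)) y<x ∷ ih
...   | no  _ | _  = [-]

fromβ-isPartition : ∀ {B} → Sorted B → IsPartition (fromβ B)
fromβ-isPartition {B} s = fromβ-positive B , fromβ-decreasing s

fromβ-∷ : ∀ {x xs} → length xs < x → fromβ (x ∷ xs) ≡ x ∸ length xs ∷ fromβ xs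
fromβ-∷ {x} {xs} n<x with length xs <? x
... | yes _   = refl
... | no  n≮x = ⊥-elim (n≮x n<x)

part-pos : ∀ μ k → 0 < part μ k → k < length μ
part-pos (_ ∷ _) zero    _ = s≤s z≤n
part-pos (_ ∷ μ) (suc k) h = s≤s (part-pos μ k h)

-- The bead at t + p slides down its runner to the vacant position t; B₂ are the beads in between.
data BeadMove (p : ℕ) : List ℕ → List ℕ → Set where
  move : ∀ B₁ t B₂ B₃ → All (t <_) B₂ → All (_< t) B₃ →
         BeadMove p (B₁ ++ t + p ∷ B₂ ++ B₃) (B₁ ++ B₂ ++ t ∷ B₃)

length-moved : ∀ B₁ (x : ℕ) B₂ t B₃ → length (B₁ ++ B₂ ++ t ∷ B₃) ≡ length (B₁ ++ x ∷ B₂ ++ B₃)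
length-moved B₁ x B₂ t B₃ = begin
  length (B₁ ++ B₂ ++ t ∷ B₃)          ≡⟨ length-++ B₁ {B₂ ++ t ∷ B₃} ⟩
  length B₁ + length (B₂ ++ t ∷ B₃)    ≡⟨ cong (length B₁ +_) (length-++ B₂) ⟩
  length B₁ + (length B₂ + suc (length B₃)) ≡⟨ cong (length B₁ +_) (+-suc (length B₂) (length B₃)) ⟩
  length B₁ + suc (length B₂ + length B₃)   ≡⟨ cong (λ n → length B₁ + suc n) (length-++ B₂ {B₃}) ⟨
  length B₁ + length (x ∷ B₂ ++ B₃)    ≡⟨ length-++ B₁ {x ∷ B₂ ++ B₃} ⟨
  length (B₁ ++ x ∷ B₂ ++ B₃)          ∎
  where open ≡-Reasoning

BeadMove-length : ∀ {p B B′} → BeadMove p B B′ → length B′ ≡ length B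
BeadMove-length (move B₁ t B₂ B₃ _ _) = length-moved B₁ _ B₂ t B₃

BeadMove-sorted : ∀ {p B B′} → Sorted B → BeadMove p B B′ → Sorted B′
BeadMove-sorted {p} s (move B₁ t B₂ B₃ t<B₂ B₃<t) with Sorted-++⁻ B₁ s
... | s₁ , (_ ∷ s₂₃) , B₁>X with Sorted-++⁻ B₂ s₂₃
... | s₂ , s₃ , B₂>B₃ =
  AllPairs.++⁺ s₁ (AllPairs.++⁺ s₂ (B₃<t ∷ s₃) (All.zipWith (λ (u>t , u>B₃) → u>t ∷ u>B₃) (t<B₂ , B₂>B₃)))
                  (All.map above-moved B₁>X)
  where
  above-moved : ∀ {u} → All (u >_) (t + p ∷ B₂ ++ B₃) → All (u >_) (B₂ ++ t ∷ B₃)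
  above-moved (u>t+p ∷ u>B₂₃) = All.++⁺ (All.++⁻ˡ B₂ u>B₂₃) (≤-<-trans (m≤m+n t p) u>t+p ∷ All.++⁻ʳ B₂ u>B₂₃)

part-rows-++ : ∀ B₁ X k → part (rows (B₁ ++ X)) (length B₁ + k) ≡ part (rows X) k
part-rows-++ []       X k = refl
part-rows-++ (_ ∷ B₁) X k = part-rows-++ B₁ X k

hookRemoved-cong : ∀ {λp μ} → (∀ k → part λp k ≡ part μ k) → ∀ i j c k → hookRemoved λp i j c k ≡ hookRemoved μ i j c k
hookRemoved-cong λ≗μ i j c k =
  cong₂ (λ x y → if (k <ᵇ i) ∨ (j <ᵇ k) then x else if k <ᵇ j then y ∸ 1 else c) (λ≗μ k) (λ≗μ (suc k))

-- Row by row, moving a bead is the removal of the rim hook from the row of the moved bead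
-- down to the row of the lowest bead it jumps over.
rows-moved-tail : ∀ {t} B₂ B₃ v k →
  part (rows (B₂ ++ t ∷ B₃)) k ≡ hookRemoved (v ∷ rows (B₂ ++ B₃)) 0 (length B₂) (t ∸ length B₃) k
rows-moved-tail []       B₃ v zero    = refl
rows-moved-tail []       B₃ v (suc k) = refl
rows-moved-tail {t} (y ∷ B₂) B₃ v zero = begin
  y ∸ length (B₂ ++ t ∷ B₃)          ≡⟨ cong (y ∸_) (length-moved [] t B₂ t B₃) ⟩
  y ∸ suc (length (B₂ ++ B₃))        ≡⟨ pred[m∸n]≡m∸[1+n] y (length (B₂ ++ B₃)) ⟨
  y ∸ length (B₂ ++ B₃) ∸ 1          ∎
  where open ≡-Reasoning
rows-moved-tail (y ∷ B₂) B₃ v (suc k) = rows-moved-tail B₂ B₃ (y ∸ length (B₂ ++ B₃)) k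

rows-moved : ∀ B₁ {x t} B₂ B₃ k →
  part (rows (B₁ ++ B₂ ++ t ∷ B₃)) k ≡ hookRemoved (rows (B₁ ++ x ∷ B₂ ++ B₃)) (length B₁) (length B₁ + length B₂) (t ∸ length B₃) k
rows-moved []              B₂ B₃ k       = rows-moved-tail B₂ B₃ _ k
rows-moved (y ∷ B₁) {x} {t} B₂ B₃ zero    = cong (y ∸_) (length-moved B₁ x B₂ t B₃)
rows-moved (y ∷ B₁)        B₂ B₃ (suc k) = rows-moved B₁ B₂ B₃ k

rows-bottom-row : ∀ {t} x B₂ B₃ → t < x → All (t <_) B₂ → length B₃ ≤ t →
  t ∸ length B₃ < part (rows (x ∷ B₂ ++ B₃)) (length B₂)
rows-bottom-row x []       B₃ t<x _             L₃≤t = ∸-monoˡ-< t<x L₃≤t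
rows-bottom-row x (y ∷ B₂) B₃ _   (t<y ∷ t<B₂) L₃≤t = rows-bottom-row y B₂ B₃ t<y t<B₂ L₃≤t

rows-after-bottom : ∀ {t} x B₂ B₃ → All (_< t) B₃ → part (rows (x ∷ B₂ ++ B₃)) (suc (length B₂)) ≤ t ∸ length B₃
rows-after-bottom x []       []       _         = z≤n
rows-after-bottom x []       (y ∷ B₃) (y<t ∷ _) = ∸-monoˡ-≤ (suc (length B₃)) y<t
rows-after-bottom x (y ∷ B₂) B₃       B₃<t      = rows-after-bottom y B₂ B₃ B₃<t

hook-length : ∀ {t p L₂ L₃} → L₃ ≤ t → L₂ ≤ p → (t + p) ∸ (L₂ + L₃) ∸ (t ∸ L₃) + L₂ ≡ p
hook-length {t} {p} {L₂} {L₃} L₃≤t L₂≤p = begin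
  (t + p) ∸ (L₂ + L₃) ∸ d + L₂         ≡⟨ cong (λ n → n ∸ (L₂ + L₃) ∸ d + L₂) t+p≡ ⟩
  (L₃ + (d + p)) ∸ (L₂ + L₃) ∸ d + L₂  ≡⟨ cong (λ n → (L₃ + (d + p)) ∸ n ∸ d + L₂) (+-comm L₂ L₃) ⟩
  (L₃ + (d + p)) ∸ (L₃ + L₂) ∸ d + L₂  ≡⟨ cong (λ n → n ∸ d + L₂) ([m+n]∸[m+o]≡n∸o L₃ (d + p) L₂) ⟩
  (d + p) ∸ L₂ ∸ d + L₂                ≡⟨ cong (λ n → n ∸ d + L₂) (+-∸-assoc d L₂≤p) ⟩
  d + (p ∸ L₂) ∸ d + L₂                ≡⟨ cong (_+ L₂) (m+n∸m≡n d (p ∸ L₂)) ⟩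
  p ∸ L₂ + L₂                          ≡⟨ m∸n+n≡m L₂≤p ⟩
  p                                    ∎
  where
  open ≡-Reasoning
  d : ℕ
  d = t ∸ L₃
  t+p≡ : t + p ≡ L₃ + (d + p)
  t+p≡ = trans (cong (_+ p) (sym (m+[n∸m]≡n L₃≤t))) (+-assoc L₃ d p)

BeadMove⇒RemoveRimHook : ∀ {p B B′} .{{_ : NonZero p}} → Sorted B → BeadMove p B B′ →
  RemoveRimHook p (fromβ B) (fromβ B′)
BeadMove⇒RemoveRimHook {p} {B} {B′} s m@(move B₁ t B₂ B₃ t<B₂ B₃<t)
  with Sorted-++⁻ B₁ s
... | _ , (X>B₂₃ ∷ s₂₃) , _ with Sorted-++⁻ B₂ s₂₃
... | s₂ , s₃ , _ =
  L₁ , L₁ + L₂ , t ∸ L₃ , m≤m+n L₁ L₂ , j<length , c<λⱼ , λⱼ₊₁≤c , length≡p ,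
  fromβ-isPartition (BeadMove-sorted s m) , pointwise
  where
  X : List ℕ
  X = t + p ∷ B₂ ++ B₃
  L₁ : ℕ
  L₁ = length B₁
  L₂ : ℕ
  L₂ = length B₂
  L₃ : ℕ
  L₃ = length B₃
  λp : Partition
  λp = fromβ B
  row : ∀ k → part λp (L₁ + k) ≡ part (rows X) k
  row k = trans (part-fromβ s (L₁ + k)) (part-rows-++ B₁ X k)
  L₃≤t : L₃ ≤ t
  L₃≤t = length-below s₃ B₃<t
  L₂≤p : L₂ ≤ p
  L₂≤p = +-cancelʳ-≤ t L₂ p (subst (L₂ + t ≤_) (+-comm t p)
           (length-between s₂ t<B₂ (All.++⁻ˡ B₂ X>B₂₃) (m≤m+n t p)))
  c<λⱼ : t ∸ L₃ < part λp (L₁ + L₂)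
  c<λⱼ = subst (t ∸ L₃ <_) (sym (row L₂)) (rows-bottom-row (t + p) B₂ B₃ (m<m+n t (>-nonZero⁻¹ p)) t<B₂ L₃≤t)
  j<length : L₁ + L₂ < length λp
  j<length = part-pos λp (L₁ + L₂) (≤-<-trans z≤n c<λⱼ)
  λⱼ₊₁≤c : part λp (suc (L₁ + L₂)) ≤ t ∸ L₃
  λⱼ₊₁≤c = subst (_≤ t ∸ L₃) (sym (trans (cong (part λp) (sym (+-suc L₁ L₂))) (row (suc L₂))))
                 (rows-after-bottom (t + p) B₂ B₃ B₃<t)
  length≡p : part λp L₁ ∸ (t ∸ L₃) + (L₁ + L₂ ∸ L₁) ≡ p
  length≡p = begin
    part λp L₁ ∸ (t ∸ L₃) + (L₁ + L₂ ∸ L₁)        ≡⟨ cong₂ (λ x y → x ∸ (t ∸ L₃) + y) λᵢ≡ (m+n∸m≡n L₁ L₂) ⟩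
    (t + p) ∸ length (B₂ ++ B₃) ∸ (t ∸ L₃) + L₂   ≡⟨ cong (λ n → (t + p) ∸ n ∸ (t ∸ L₃) + L₂) (length-++ B₂) ⟩
    (t + p) ∸ (L₂ + L₃) ∸ (t ∸ L₃) + L₂           ≡⟨ hook-length L₃≤t L₂≤p ⟩
    p                                             ∎
    where
    open ≡-Reasoning
    λᵢ≡ : part λp L₁ ≡ (t + p) ∸ length (B₂ ++ B₃)
    λᵢ≡ = trans (cong (part λp) (sym (+-identityʳ L₁))) (row 0)
  pointwise : ∀ k → part (fromβ B′) k ≡ hookRemoved λp L₁ (L₁ + L₂) (t ∸ L₃) k
  pointwise k = trans (part-fromβ (BeadMove-sorted s m) k)
    (trans (rows-moved B₁ {t + p} B₂ B₃ k)
           (hookRemoved-cong {rows B} {λp} (λ k → sym (part-fromβ s k)) L₁ (L₁ + L₂) (t ∸ L₃) k))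

BeadMoves⇒RemoveRimHooks : ∀ {p B B′} .{{_ : NonZero p}} → Sorted B → Star (BeadMove p) B B′ →
  Star (RemoveRimHook p) (fromβ B) (fromβ B′)
BeadMoves⇒RemoveRimHooks s ε        = ε
BeadMoves⇒RemoveRimHooks s (m ◅ ms) = BeadMove⇒RemoveRimHook s m ◅ BeadMoves⇒RemoveRimHooks (BeadMove-sorted s m) ms

BeadMoves-length : ∀ {p B B′} → Star (BeadMove p) B B′ → length B′ ≡ length B
BeadMoves-length ε        = refl
BeadMoves-length (m ◅ ms) = trans (BeadMoves-length ms) (BeadMove-length m)

BeadMove-++ˡ : ∀ {p B B′} P → BeadMove p B B′ → BeadMove p (P ++ B) (P ++ B′)
BeadMove-++ˡ {p} P (move B₁ t B₂ B₃ t<B₂ B₃<t) =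
  subst₂ (BeadMove p) (++-assoc P B₁ _) (++-assoc P B₁ _) (move (P ++ B₁) t B₂ B₃ t<B₂ B₃<t)

BeadMoves-++ˡ : ∀ {p B B′} P → Star (BeadMove p) B B′ → Star (BeadMove p) (P ++ B) (P ++ B′)
BeadMoves-++ˡ P = Star.gmap (P ++_) (BeadMove-++ˡ P)

run : ℕ → ℕ → List ℕ
run s a = applyDownFrom (s +_) a

-- z beads at 0, …, z − 1 and b beads at w, …, w + b − 1: the rectangle ((w − z)^b) padded by z empty rows.
rectβ : ℕ → ℕ → ℕ → List ℕ
rectβ z w b = run w b ++ downFrom z

run-above : ∀ s a → All (s ≤_) (run s a)
run-above s a = All.applyDownFrom⁺₁ (s +_) a (λ _ → m≤m+n s _)

run-below : ∀ {s a m} → s + a ≤ m → All (_< m) (run s a)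
run-below {s} {a} s+a≤m = All.applyDownFrom⁺₁ (s +_) a (λ i<a → <-≤-trans (+-monoʳ-< s i<a) s+a≤m)

run-sorted : ∀ s a → Sorted (run s a)
run-sorted s a = AllPairs.applyDownFrom⁺₁ (s +_) a (λ j<i _ → +-monoʳ-< s j<i)

downFrom-below : ∀ {z m} → z ≤ m → All (_< m) (downFrom z)
downFrom-below = run-below

run-below⁻ : ∀ {s a m} → All (_< m) (run s a) → a ≡ 0 ⊎ s + a ≤ m
run-below⁻ {a = zero}          _           = inj₁ refl
run-below⁻ {s} {suc a} {m} (s+a<m ∷ _) = inj₂ (subst (_≤ m) (sym (+-suc s a)) s+a<m)

downFrom-below⁻ : ∀ {z m} → All (_< m) (downFrom z) → z ≤ m
downFrom-below⁻ {zero}  _           = z≤n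
downFrom-below⁻ {suc z} (z<m ∷ _) = z<m

run-++-sorted : ∀ {s a B} → Sorted B → All (_< s) B → Sorted (run s a ++ B)
run-++-sorted {s} {a} sB B<s =
  AllPairs.++⁺ (run-sorted s a) sB (All.map (λ s≤u → All.map (λ v<s → <-≤-trans v<s s≤u) B<s) (run-above s a))

run-suc-++ : ∀ w b C → run (suc w) b ++ w ∷ C ≡ run w (suc b) ++ C
run-suc-++ w zero    C = cong (_∷ C) (sym (+-identityʳ w))
run-suc-++ w (suc b) C = cong₂ _∷_ (sym (+-suc w b)) (run-suc-++ w b C)

run-++-downFrom : ∀ z b → run z b ++ downFrom z ≡ downFrom (z + b)
run-++-downFrom z zero    = cong downFrom (sym (+-identityʳ z))
run-++-downFrom z (suc b) = trans (cong (z + b ∷_) (run-++-downFrom z b)) (cong downFrom (sym (+-suc z b)))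

length-run : ∀ s a → length (run s a) ≡ a
length-run s = length-applyDownFrom (s +_)

length-rectβ : ∀ z w b → length (rectβ z w b) ≡ b + z
length-rectβ z w b = trans (length-++ (run w b)) (cong₂ _+_ (length-run w b) (length-downFrom z))

fromβ-downFrom : ∀ z → fromβ (downFrom z) ≡ []
fromβ-downFrom zero    = refl
fromβ-downFrom (suc z) with length (downFrom z) <? z
... | yes n<z = ⊥-elim (<-irrefl (length-downFrom z) n<z)
... | no  _   = refl

fromβ-run-++ : ∀ s a {B} → length B < s → fromβ (run s a ++ B) ≡ replicate a (s ∸ length B) ++ fromβ B
fromβ-run-++ s zero    _       = refl
fromβ-run-++ s (suc a) {B} L<s = trans (fromβ-∷ length<) (cong₂ _∷_ head≡ (fromβ-run-++ s a L<s))
  where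
  L : ℕ
  L = length B
  length≡ : length (run s a ++ B) ≡ a + L
  length≡ = trans (length-++ (run s a)) (cong (_+ L) (length-run s a))
  length< : length (run s a ++ B) < s + a
  length< = subst₂ _<_ (sym (trans length≡ (+-comm a L))) refl (+-monoˡ-< a L<s)
  head≡ : s + a ∸ length (run s a ++ B) ≡ s ∸ L
  head≡ = trans (cong₂ _∸_ (+-comm s a) length≡) ([m+n]∸[m+o]≡n∸o a s L)

rect-replicate : ∀ {c} b → 0 < c → rect c b ≡ replicate b c
rect-replicate {suc c} b _ = refl

fromβ-rectβ : ∀ {z w} b → z < w → fromβ (rectβ z w b) ≡ rect (w ∸ z) b
fromβ-rectβ {z} {w} b z<w = begin
  fromβ (run w b ++ downFrom z)                                ≡⟨ fromβ-run-++ w b (subst (_< w) (sym (length-downFrom z)) z<w) ⟩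
  replicate b (w ∸ length (downFrom z)) ++ fromβ (downFrom z)  ≡⟨ cong₂ (λ n μ → replicate b (w ∸ n) ++ μ) (length-downFrom z) (fromβ-downFrom z) ⟩
  replicate b (w ∸ z) ++ []                                    ≡⟨ ++-identityʳ _ ⟩
  replicate b (w ∸ z)                                          ≡⟨ rect-replicate b (m<n⇒0<n∸m z<w) ⟨
  rect (w ∸ z) b                                               ∎
  where open ≡-Reasoning

part-replicate : ∀ {b} v {i} → i < b → part (replicate b v) i ≡ v
part-replicate {suc b} v {zero}  _         = refl
part-replicate {suc b} v {suc i} (s≤s i<b) = part-replicate v i<b

rect-noRimHook : ∀ {p c b} → c + b ≤ p → ∀ ν → ¬ RemoveRimHook p (rect c b) ν
rect-noRimHook {c = zero} _ ν (_ , _ , _ , _ , () , _)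
rect-noRimHook {p} {suc c} {b} c+b≤p ν (i , j , c′ , i≤j , j<length , _ , _ , length≡p , _) =
  <-irrefl length≡p (begin-strict
    part (replicate b (suc c)) i ∸ c′ + (j ∸ i)  ≤⟨ +-mono-≤ (≤-trans (m∸n≤m _ c′) (≤-reflexive (part-replicate (suc c) i<b))) (m∸n≤m j i) ⟩
    suc c + j                                    <⟨ +-monoʳ-< (suc c) j<b ⟩
    suc c + b                                    ≤⟨ c+b≤p ⟩
    p                                            ∎)
  where
  open ≤-Reasoning
  j<b : j < b
  j<b = subst (j <_) (length-replicate b) j<length
  i<b : i < b
  i<b = ≤-<-trans i≤j j<b

rect-empty : ∀ c → rect c 0 ≡ []
rect-empty zero    = refl
rect-empty (suc c) = refl

rect-cong : ∀ {c c′ b b′} → b ≡ b′ → (0 < b → c ≡ c′) → rect c b ≡ rect c′ b′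
rect-cong {c} {c′} {zero}  refl _     = trans (rect-empty c) (sym (rect-empty c′))
rect-cong         {b = suc b} refl c≡c′ = cong (λ x → rect x (suc b)) (c≡c′ z<s)

numParts : Blocks → ℕ
numParts bs = length (toPartition bs)

numParts-∷ : ∀ l a bs → numParts ((l , a) ∷ bs) ≡ a + numParts bs
numParts-∷ l a bs = trans (length-++ (replicate a l)) (cong (_+ numParts bs) (length-replicate a))

block-top-≤ : ∀ {l₂ l} a₂ bs → l₂ ≤ l → l₂ + numParts bs + a₂ ≤ l + numParts ((l₂ , a₂) ∷ bs)
block-top-≤ {l₂} {l} a₂ bs l₂≤l = begin
  l₂ + numParts bs + a₂            ≡⟨ +-assoc l₂ (numParts bs) a₂ ⟩
  l₂ + (numParts bs + a₂)          ≡⟨ cong (l₂ +_) (trans (+-comm (numParts bs) a₂) (sym (numParts-∷ l₂ a₂ bs))) ⟩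
  l₂ + numParts ((l₂ , a₂) ∷ bs)   ≤⟨ +-monoˡ-≤ _ l₂≤l ⟩
  l + numParts ((l₂ , a₂) ∷ bs)    ∎
  where open ≤-Reasoning

beadsOf : Blocks → List ℕ
beadsOf []             = []
beadsOf ((l , a) ∷ bs) = run (l + numParts bs) a ++ beadsOf bs

length-beadsOf : ∀ bs → length (beadsOf bs) ≡ numParts bs
length-beadsOf []             = refl
length-beadsOf ((l , a) ∷ bs) = begin
  length (run (l + numParts bs) a ++ beadsOf bs)          ≡⟨ length-++ (run (l + numParts bs) a) ⟩
  length (run (l + numParts bs) a) + length (beadsOf bs)  ≡⟨ cong₂ _+_ (length-run _ a) (length-beadsOf bs) ⟩
  a + numParts bs                                         ≡⟨ numParts-∷ l a bs ⟨
  numParts ((l , a) ∷ bs)                                 ∎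
  where open ≡-Reasoning

fromβ-beadsOf : ∀ {bs} → All (λ x → 0 < proj₁ x) bs → fromβ (beadsOf bs) ≡ toPartition bs
fromβ-beadsOf {[]}           []         = refl
fromβ-beadsOf {(l , a) ∷ bs} (0<l ∷ ps) = begin
  fromβ (run (l + n) a ++ beadsOf bs)                        ≡⟨ fromβ-run-++ (l + n) a length< ⟩
  replicate a (l + n ∸ length (beadsOf bs)) ++ fromβ (beadsOf bs) ≡⟨ cong₂ (λ m μ → replicate a (l + n ∸ m) ++ μ) (length-beadsOf bs) (fromβ-beadsOf ps) ⟩
  replicate a (l + n ∸ n) ++ toPartition bs                  ≡⟨ cong (λ m → replicate a m ++ toPartition bs) (m+n∸n≡m l n) ⟩
  replicate a l ++ toPartition bs                            ∎
  where
  open ≡-Reasoning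
  n : ℕ
  n = numParts bs
  length< : length (beadsOf bs) < l + n
  length< = subst (_< l + n) (sym (length-beadsOf bs)) (m<n+m n 0<l)

beadsOf-sorted-below : ∀ {l a bs} → Linked (λ x y → proj₁ y < proj₁ x) ((l , a) ∷ bs) →
  Sorted (beadsOf ((l , a) ∷ bs)) × All (_< l + numParts bs + a) (beadsOf ((l , a) ∷ bs))
beadsOf-sorted-below {l} {a} {[]} _ = run-++-sorted [] [] , All.++⁺ (run-below {a = a} ≤-refl) []
beadsOf-sorted-below {l} {a} {(l₂ , a₂) ∷ bs} (l₂<l ∷ linked) with beadsOf-sorted-below linked
... | sorted₂ , below₂ = run-++-sorted {a = a} sorted₂ below-s ,
  All.++⁺ (run-below {a = a} ≤-refl) (All.map (λ u<s → <-≤-trans u<s (m≤m+n (l + numParts ((l₂ , a₂) ∷ bs)) a)) below-s)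
  where
  below-s : All (_< l + numParts ((l₂ , a₂) ∷ bs)) (beadsOf ((l₂ , a₂) ∷ bs))
  below-s = All.map (λ u<top → <-≤-trans u<top (block-top-≤ a₂ bs (<⇒≤ l₂<l))) below₂

Anchored : ℕ → ℕ → ℕ → ℕ → Set
Anchored p z w b = z ≡ 0 mod p ⊎ w + b ≡ 0 mod p

record CoreShape (p z w b : ℕ) : Set where
  field
    z<w      : z < w
    width    : w ∸ z + b ≤ p
    anchored : Anchored p z w b

data CoreResidues (p α r c b : ℕ) : Set where
  bottomAligned : b ≡ r mod p → c ≡ α + r mod p → CoreResidues p α r c b
  topAligned    : c + r ≡ 0 mod p → α + r + b ≡ 0 mod p → CoreResidues p α r c b

coreResidues : ∀ {p α r z w b} → z < w → Anchored p z w b → z + b ≡ r mod p → w ≡ α + r mod p →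
  CoreResidues p α r (w ∸ z) b
coreResidues {p} {α} {r} {z} {w} {b} z<w (inj₁ z≡0) z+b≡r w≡α+r = bottomAligned b≡r c≡α+r
  where
  open ≡-mod-Reasoning p
  b≡r : b ≡ r mod p
  b≡r = begin
    b       ≈⟨ +-≡-mod (≡-mod-sym z≡0) (≡-mod-refl {a = b}) ⟩
    z + b   ≈⟨ z+b≡r ⟩
    r       ∎
  c≡α+r : w ∸ z ≡ α + r mod p
  c≡α+r = begin
    w ∸ z       ≡⟨ +-identityʳ (w ∸ z) ⟨
    w ∸ z + 0   ≈⟨ +-≡-mod (≡-mod-refl {a = w ∸ z}) z≡0 ⟨
    w ∸ z + z   ≡⟨ m∸n+n≡m (<⇒≤ z<w) ⟩
    w           ≈⟨ w≡α+r ⟩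
    α + r       ∎
coreResidues {p} {α} {r} {z} {w} {b} z<w (inj₂ w+b≡0) z+b≡r w≡α+r = topAligned c+r≡0 α+r+b≡0
  where
  open ≡-mod-Reasoning p
  c+r≡0 : w ∸ z + r ≡ 0 mod p
  c+r≡0 = begin
    w ∸ z + r         ≈⟨ +-≡-mod (≡-mod-refl {a = w ∸ z}) z+b≡r ⟨
    w ∸ z + (z + b)   ≡⟨ +-assoc (w ∸ z) z b ⟨
    w ∸ z + z + b     ≡⟨ cong (_+ b) (m∸n+n≡m (<⇒≤ z<w)) ⟩
    w + b             ≈⟨ w+b≡0 ⟩
    0                 ∎
  α+r+b≡0 : α + r + b ≡ 0 mod p
  α+r+b≡0 = begin
    α + r + b   ≈⟨ +-≡-mod w≡α+r (≡-mod-refl {a = b}) ⟨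
    w + b       ≈⟨ w+b≡0 ⟩
    0           ∎

module Sliding (p : ℕ) .{{_ : NonZero p}} where

  move-top : ∀ {x t} W B → x ≡ t + p → All (t <_) W → All (_< t) B → BeadMove p (x ∷ W ++ B) (W ++ t ∷ B)
  move-top {t = t} W B refl t<W B<t = move [] t W B t<W B<t

  slideBead : ∀ k {W z w b} → z ≤ w → b < p → All (w + k * p <_) W →
    Star (BeadMove p) (w + suc k * p ∷ W ++ rectβ z (suc w) b) (W ++ rectβ z w (suc b))
  slideBead zero {W} {z} {w} {b} z≤w b<p w<W =
    subst₂ (Star (BeadMove p)) (cong (_ ∷_) (++-assoc W (run (suc w) b) (downFrom z))) landed
      (move-top (W ++ run (suc w) b) (downFrom z) (cong (w +_) (+-identityʳ p))
                (All.++⁺ (All.map (≤-<-trans (≤-reflexive (sym (+-identityʳ w)))) w<W) (run-above (suc w) b))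
                (downFrom-below z≤w)
       ◅ ε)
    where
    landed : (W ++ run (suc w) b) ++ w ∷ downFrom z ≡ W ++ rectβ z w (suc b)
    landed = trans (++-assoc W (run (suc w) b) _) (cong (W ++_) (run-suc-++ w b (downFrom z)))
  slideBead (suc k) {W} {z} {w} {b} z≤w b<p w<W =
    move-top W (rectβ z (suc w) b) x≡ w<W (All.++⁺ (run-below top<) (downFrom-below (≤-trans z≤w (m≤m+n w _))))
    ◅ BeadMoves-++ˡ W (slideBead k {[]} z≤w b<p [])
    where
    x≡ : w + suc (suc k) * p ≡ w + suc k * p + p
    x≡ = solve 3 (λ w k p → w :+ (con 2 :+ k) :* p := w :+ (con 1 :+ k) :* p :+ p) refl w k p
    top< : suc w + b ≤ w + suc k * p
    top< = ≤-trans (≤-reflexive (sym (+-suc w b))) (+-monoʳ-≤ w (≤-trans b<p (m≤m+n p (k * p))))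

  normalise : ∀ {z w b} → z ≤ w → w ∸ z + b ≤ p → Anchored p z w b →
    ∃[ z′ ] ∃[ w′ ] ∃[ b′ ] rectβ z w b ≡ rectβ z′ w′ b′ × CoreShape p z′ w′ b′ × (w′ ≡ w mod p)
  normalise {z} {w} {b} z≤w width anchored with m≤n⇒m<n∨m≡n z≤w
  ... | inj₁ z<w  = z , w , b , refl , record { z<w = z<w ; width = width ; anchored = anchored } , ≡-mod-refl
  ... | inj₂ refl = merge (positive-residue (p ∸ b))
    where
    -- the two runs have merged; the empty upper run is placed d ≡ − b slots above, keeping w mod p
    b≤p : b ≤ p
    b≤p = subst (λ n → n + b ≤ p) (n∸n≡0 z) width
    merge : ∃[ d ] 0 < d × d ≤ p × d ≡ p ∸ b mod p →
      ∃[ z′ ] ∃[ w′ ] ∃[ b′ ] rectβ z z b ≡ rectβ z′ w′ b′ × CoreShape p z′ w′ b′ × (w′ ≡ z mod p)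
    merge (d , 0<d , d≤p , d≡p∸b) = z + b , z + b + d , 0 , run-++-downFrom z b , shape , w′≡z
      where
      open ≡-mod-Reasoning p
      b+d≡0 : b + d ≡ 0 mod p
      b+d≡0 = begin
        b + d         ≈⟨ +-≡-mod (≡-mod-refl {a = b}) d≡p∸b ⟩
        b + (p ∸ b)   ≡⟨ m+[n∸m]≡n b≤p ⟩
        p             ≈⟨ m+p≡m-mod 0 ⟩
        0             ∎
      w′≡z : z + b + d ≡ z mod p
      w′≡z = begin
        z + b + d     ≡⟨ +-assoc z b d ⟩
        z + (b + d)   ≈⟨ +-≡-mod (≡-mod-refl {a = z}) b+d≡0 ⟩
        z + 0         ≡⟨ +-identityʳ z ⟩
        z             ∎
      shape : CoreShape p (z + b) (z + b + d) 0
      shape = record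
        { z<w      = m<m+n (z + b) 0<d
        ; width    = subst (_≤ p) (sym (trans (+-identityʳ _) (m+n∸m≡n (z + b) d))) d≤p
        ; anchored = [ (λ z≡0 → inj₂ (subst (_≡ 0 mod p) (sym (+-identityʳ _)) (≡-mod-trans w′≡z z≡0))) , inj₁ ]′ anchored
        }

  record SlidesTo (B : List ℕ) (top w₀ : ℕ) : Set where
    field
      z w b : ℕ
      moves : Star (BeadMove p) B (rectβ z w b)
      shape : CoreShape p z w b
      below : All (_< top) (rectβ z w b)
      w≡w₀  : w ≡ w₀ mod p

  settle : ∀ {B z w b w₀ top} → B ≡ rectβ z w b → z ≤ w → w ∸ z + b ≤ p → Anchored p z w b →
    All (_< top) B → w ≡ w₀ mod p → SlidesTo B top w₀
  settle {B} refl z≤w width anchored below w≡w₀ with normalise z≤w width anchored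
  ... | z′ , w′ , b′ , B≡ , shape , w′≡w = record
    { z = z′ ; w = w′ ; b = b′ ; moves = subst (Star (BeadMove p) B) B≡ ε ; shape = shape
    ; below = subst (All (_< _)) B≡ below ; w≡w₀ = ≡-mod-trans w′≡w w≡w₀ }

  slot≤bead : ∀ {s a z w b} → CoreShape p z (suc w) b → All (_< s) (rectβ z (suc w) b) → s + a ≡ w mod p →
    w ≤ s + a
  slot≤bead {s} {a} {z} {w} {b} shape below s+a≡w =
    ≮⇒≥ λ s+a<w → <⇒≱ w<s+a+p (≡-mod-<⇒+p≤ (≡-mod-sym s+a≡w) s+a<w)
    where
    open CoreShape shape
    w<s+a+p : w < s + a + p
    w<s+a+p = begin-strict
      w                   <⟨ n<1+n w ⟩
      suc w               ≡⟨ m+[n∸m]≡n (<⇒≤ z<w) ⟨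
      z + (suc w ∸ z)     ≤⟨ +-mono-≤ (≤-trans (downFrom-below⁻ (All.++⁻ʳ (run (suc w) b) below)) (m≤m+n s a))
                                      (m+n≤o⇒m≤o _ width) ⟩
      s + a + p           ∎
      where open ≤-Reasoning

  slideTop-inPlace : ∀ {s a z w b} → CoreShape p z (suc w) b → All (_< s) (rectβ z (suc w) b) → s + a ≡ w →
    SlidesTo (run s (suc a) ++ rectβ z (suc w) b) (s + suc a) s
  slideTop-inPlace {s} {a} {z} {w} {b} shape below s+a≡w =
    settle in-place z≤s width′ anchored′ below′ ≡-mod-refl
    where
    open CoreShape shape
    z≤s : z ≤ s
    z≤s = downFrom-below⁻ (All.++⁻ʳ (run (suc w) b) below)
    w+1≡s+a+1 : suc w ≡ s + suc a
    w+1≡s+a+1 = trans (cong suc (sym s+a≡w)) (sym (+-suc s a))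
    b≡0 : b ≡ 0
    b≡0 with run-below⁻ (All.++⁻ˡ (run (suc w) b) below)
    ... | inj₁ b≡0   = b≡0
    ... | inj₂ w+b≤s = ⊥-elim (1+n≰n (begin
      suc w       ≤⟨ m≤m+n (suc w) b ⟩
      suc w + b   ≤⟨ w+b≤s ⟩
      s           ≤⟨ m≤m+n s a ⟩
      s + a       ≡⟨ s+a≡w ⟩
      w           ∎))
      where open ≤-Reasoning
    in-place : run s (suc a) ++ rectβ z (suc w) b ≡ rectβ z s (suc a)
    in-place = cong (λ n → run s (suc a) ++ rectβ z (suc w) n) b≡0
    width′ : s ∸ z + suc a ≤ p
    width′ = subst (_≤ p) (begin
      suc w ∸ z + b   ≡⟨ cong (suc w ∸ z +_) b≡0 ⟩
      suc w ∸ z + 0   ≡⟨ +-identityʳ _ ⟩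
      suc w ∸ z       ≡⟨ cong (_∸ z) w+1≡s+a+1 ⟩
      s + suc a ∸ z   ≡⟨ +-∸-comm (suc a) z≤s ⟩
      s ∸ z + suc a   ∎) width
      where open ≡-Reasoning
    anchored′ : Anchored p z s (suc a)
    anchored′ = map₂ (subst (_≡ 0 mod p) (trans (cong (suc w +_) b≡0) (trans (+-identityʳ _) w+1≡s+a+1))) anchored
    below′ : All (_< s + suc a) (run s (suc a) ++ rectβ z (suc w) b)
    below′ = All.++⁺ (run-below ≤-refl) (All.map (λ u<s → <-≤-trans u<s (m≤m+n s (suc a))) below)

  landed-shape : ∀ {s z w b} → CoreShape p z (suc w) b → All (_< s) (rectβ z (suc w) b) → w < s →
    w ∸ z + suc b ≤ p × Anchored p z w (suc b) × All (_< s) (rectβ z w (suc b))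
  landed-shape {s} {z} {w} {b} shape below w<s = width₁ , map₂ (subst (_≡ 0 mod p) (sym (+-suc w b))) anchored , below₁
    where
    open CoreShape shape
    width₁ : w ∸ z + suc b ≤ p
    width₁ = subst (_≤ p) (trans (cong (_+ b) (+-∸-assoc 1 (≤-pred z<w))) (sym (+-suc (w ∸ z) b))) width
    w+b<s : w + suc b ≤ s
    w+b<s with run-below⁻ (All.++⁻ˡ (run (suc w) b) below)
    ... | inj₁ refl  = subst (_≤ s) (sym (+-comm w 1)) w<s
    ... | inj₂ w+b≤s = subst (_≤ s) (sym (+-suc w b)) w+b≤s
    below₁ : All (_< s) (rectβ z w (suc b))
    below₁ = All.++⁺ (run-below w+b<s) (All.++⁻ʳ (run (suc w) b) below)

  mutual
    slideRun : ∀ a {s z w b} → a < p → z ≤ w → w ∸ z + b ≤ p → Anchored p z w b →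
      All (_< s) (rectβ z w b) → s + a ≡ w mod p → SlidesTo (run s a ++ rectβ z w b) (s + a) s
    slideRun zero {s} _ z≤w width anchored below s+0≡w =
      settle refl z≤w width anchored (subst (λ m → All (_< m) _) (sym (+-identityʳ s)) below)
             (≡-mod-sym (subst (_≡ _ mod p) (+-identityʳ s) s+0≡w))
    slideRun (suc a) {s} a<p z≤w width anchored below s+a≡w with normalise z≤w width anchored
    ... | z′ , w′ , b′ , B≡ , shape , w′≡w =
      subst (λ B → SlidesTo (run s (suc a) ++ B) (s + suc a) s) (sym B≡)
            (slideTop a a<p shape (subst (All (_< s)) B≡ below) (≡-mod-trans s+a≡w (≡-mod-sym w′≡w)))

    slideTop : ∀ a {s z w b} → suc a < p → CoreShape p z w b → All (_< s) (rectβ z w b) → s + suc a ≡ w mod p →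
      SlidesTo (run s (suc a) ++ rectβ z w b) (s + suc a) s
    slideTop a {w = zero} _ shape _ _ = ⊥-elim (n≮0 (CoreShape.z<w shape))
    slideTop a {s} {z} {suc w} {b} 1+a<p shape below s+a+1≡w+1 = landing (≡-mod-≤⇒∃ s+a≡w (slot≤bead shape below s+a≡w))
      where
      open CoreShape shape
      s+a≡w : s + a ≡ w mod p
      s+a≡w = +-cancelˡ-≡-mod 1 (subst (_≡ suc w mod p) (+-suc s a) s+a+1≡w+1)
      landing : ∃[ k ] s + a ≡ w + k * p → SlidesTo (run s (suc a) ++ rectβ z (suc w) b) (s + suc a) s
      landing (zero  , s+a≡w+0)  = slideTop-inPlace shape below (trans s+a≡w+0 (+-identityʳ w))
      landing (suc k , s+a≡w+kp) = record
        { z = z′ ; w = w′ ; b = b′ ; moves = step ◅◅ moves ; shape = shape′ ; w≡w₀ = w′≡s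
        ; below = All.map (λ u<s+a → <-≤-trans u<s+a (+-monoʳ-≤ s (n≤1+n a))) below′ }
        where
        a<p : a < p
        a<p = <-trans (n<1+n a) 1+a<p
        z≤w : z ≤ w
        z≤w = ≤-pred z<w
        w+kp<s : w + k * p < s
        w+kp<s = +-cancelʳ-< p (w + k * p) s (begin-strict
          w + k * p + p       ≡⟨ solve 3 (λ w k p → w :+ k :* p :+ p := w :+ (con 1 :+ k) :* p) refl w k p ⟩
          w + suc k * p       ≡⟨ s+a≡w+kp ⟨
          s + a               <⟨ +-monoʳ-< s a<p ⟩
          s + p               ∎)
          where open ≤-Reasoning
        step : Star (BeadMove p) (run s (suc a) ++ rectβ z (suc w) b) (run s a ++ rectβ z w (suc b))
        step = subst (λ x → Star (BeadMove p) (x ∷ run s a ++ rectβ z (suc w) b) (run s a ++ rectβ z w (suc b)))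
                     (sym s+a≡w+kp)
                     (slideBead k z≤w (<-≤-trans (m<n+m b (m<n⇒0<n∸m z<w)) width)
                                (All.map (<-≤-trans w+kp<s) (run-above s a)))
        landed : w ∸ z + suc b ≤ p × Anchored p z w (suc b) × All (_< s) (rectβ z w (suc b))
        landed = landed-shape shape below (≤-<-trans (m≤m+n w (k * p)) w+kp<s)
        open SlidesTo (slideRun a a<p z≤w (proj₁ landed) (proj₁ (proj₂ landed)) (proj₂ (proj₂ landed)) s+a≡w)
          renaming (z to z′; w to w′; b to b′; shape to shape′; below to below′; w≡w₀ to w′≡s)

  slideJS : ∀ {l a bs} → IsJSBlocks p ((l , a) ∷ bs) →
    SlidesTo (beadsOf ((l , a) ∷ bs)) (l + numParts bs + a) (l + numParts bs)
  slideJS {l} {a} {[]} (_ , (_ , _ , a<p) ∷ [] , _) =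
    let (w₀ , _ , w₀≤p , w₀≡) = positive-residue (l + 0 + a)
    in  slideRun a a<p z≤n (subst (_≤ p) (sym (+-identityʳ w₀)) w₀≤p) (inj₁ ≡-mod-refl) [] (≡-mod-sym w₀≡)
  slideJS {l} {a} {(l₂ , a₂) ∷ bs} (_ , (_ , _ , a<p) ∷ valid , (l₂<l , p∣gap) ∷ linked) = record
    { z = z′ ; w = w′ ; b = b′ ; moves = BeadMoves-++ˡ (run s a) moves ◅◅ moves′
    ; shape = shape′ ; below = below′ ; w≡w₀ = w′≡s }
    where
    n : ℕ
    n = numParts bs
    s : ℕ
    s = l + numParts ((l₂ , a₂) ∷ bs)
    open SlidesTo (slideJS (nonEmpty _ _ , valid , linked))
    open CoreShape shape
    s+a≡ : s + a ≡ (l ∸ l₂) + a + a₂ + (l₂ + n)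
    s+a≡ = begin
      l + numParts ((l₂ , a₂) ∷ bs) + a   ≡⟨ cong (λ m → l + m + a) (numParts-∷ l₂ a₂ bs) ⟩
      l + (a₂ + n) + a                    ≡⟨ cong (λ m → m + (a₂ + n) + a) (sym (m∸n+n≡m (<⇒≤ l₂<l))) ⟩
      (l ∸ l₂) + l₂ + (a₂ + n) + a        ≡⟨ solve 5 (λ d l₂ a₂ n a → d :+ l₂ :+ (a₂ :+ n) :+ a := d :+ a :+ a₂ :+ (l₂ :+ n)) refl (l ∸ l₂) l₂ a₂ n a ⟩
      (l ∸ l₂) + a + a₂ + (l₂ + n)        ∎
      where open ≡-Reasoning
    s+a≡w : s + a ≡ w mod p
    s+a≡w = begin
      s + a                          ≡⟨ s+a≡ ⟩
      (l ∸ l₂) + a + a₂ + (l₂ + n)   ≈⟨ +-≡-mod (n≡0-mod p∣gap) (≡-mod-refl {a = l₂ + n}) ⟩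
      l₂ + n                         ≈⟨ w≡w₀ ⟨
      w                              ∎
      where open ≡-mod-Reasoning p
    below-s : All (_< s) (rectβ z w b)
    below-s = All.map (λ u<top → <-≤-trans u<top (block-top-≤ a₂ bs (<⇒≤ l₂<l))) below
    open SlidesTo (slideRun a a<p (<⇒≤ z<w) width anchored below-s s+a≡w)
      renaming (z to z′; w to w′; b to b′; moves to moves′; shape to shape′; below to below′; w≡w₀ to w′≡s)

  jsType+a≡l : ∀ {l a bs} → a ≤ p → jsType p ((l , a) ∷ bs) + a ≡ l mod p
  jsType+a≡l {l} {a} a≤p = begin
    (l + p ∸ a) % p + a   ≈⟨ +-≡-mod (%-≡-mod (l + p ∸ a)) (≡-mod-refl {a = a}) ⟩
    l + p ∸ a + a         ≡⟨ m∸n+n≡m (≤-trans a≤p (m≤n+m p l)) ⟩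
    l + p                 ≈⟨ m+p≡m-mod l ⟩
    l                     ∎
    where open ≡-mod-Reasoning p

  pCoreOf-JS : ∀ {bs α r} → IsJSBlocks p bs → jsType p bs ≡ α → numParts bs ≡ r mod p →
    ∃[ c ] ∃[ b ] IsPCoreOf p (toPartition bs) (rect c b) × 0 < c × c + b ≤ p × CoreResidues p α r c b
  pCoreOf-JS {[]} (() , _)
  pCoreOf-JS {bs@((l , a) ∷ rest)} {α} {r} js@(_ , valid@((_ , _ , a<p) ∷ _) , linked) type≡α N≡r =
    w ∸ z , b , (rimHooks , rect-noRimHook {c = w ∸ z} {b} width) , m<n⇒0<n∸m z<w , width ,
    coreResidues z<w anchored z+b≡r w≡α+r
    where
    open SlidesTo (slideJS js)
    open CoreShape shape
    rimHooks : Star (RemoveRimHook p) (toPartition bs) (rect (w ∸ z) b)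
    rimHooks = subst₂ (Star (RemoveRimHook p)) (fromβ-beadsOf (All.map proj₁ valid)) (fromβ-rectβ b z<w)
                 (BeadMoves⇒RemoveRimHooks (proj₁ (beadsOf-sorted-below (Linked.map proj₁ linked))) moves)
    z+b≡r : z + b ≡ r mod p
    z+b≡r = subst (_≡ r mod p) (sym (begin
      z + b                  ≡⟨ +-comm z b ⟩
      b + z                  ≡⟨ length-rectβ z w b ⟨
      length (rectβ z w b)   ≡⟨ BeadMoves-length moves ⟩
      length (beadsOf bs)    ≡⟨ length-beadsOf bs ⟩
      numParts bs            ∎)) N≡r
      where open ≡-Reasoning
    w≡α+r : w ≡ α + r mod p
    w≡α+r = begin
      w                   ≈⟨ w≡w₀ ⟩
      l + numParts rest   ≈⟨ +-≡-mod (jsType+a≡l {bs = rest} (<⇒≤ a<p)) (≡-mod-refl {a = numParts rest}) ⟨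
      jsType p bs + a + numParts rest ≡⟨ cong (λ x → x + a + numParts rest) type≡α ⟩
      α + a + numParts rest ≡⟨ +-assoc α a (numParts rest) ⟩
      α + (a + numParts rest) ≡⟨ cong (α +_) (numParts-∷ l a rest) ⟨
      α + numParts bs     ≈⟨ +-≡-mod (≡-mod-refl {a = α}) N≡r ⟩
      α + r               ∎
      where open ≡-mod-Reasoning p

  jsType<p : ∀ bs → jsType p bs < p
  jsType<p []            = >-nonZero⁻¹ p
  jsType<p ((l , a) ∷ _) = m%n<n (l + p ∸ a) p

module Classification {p α β r c b : ℕ} (α+β≡p : α + β ≡ p) (r<p : r < p) (0<c : 0 < c) (c+b≤p : c + b ≤ p) where

  private
    c≤p : c ≤ p
    c≤p = m+n≤o⇒m≤o c c+b≤p

    b<p : b < p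
    b<p = <-≤-trans (m<n+m b 0<c) c+b≤p

    0≡p : 0 ≡ p mod p
    0≡p = ≡-mod-sym (m+p≡m-mod 0)

    top-c : c + r ≡ 0 mod p → c ≡ p ∸ r
    top-c c+r≡0 = ≡-mod-≤p⇒≡ (+-cancelʳ-≡-mod r c+r≡p∸r+r) 0<c c≤p (m<n⇒0<n∸m r<p) (m∸n≤m p r)
      where
      c+r≡p∸r+r : c + r ≡ p ∸ r + r mod p
      c+r≡p∸r+r = begin
        c + r       ≈⟨ c+r≡0 ⟩
        0           ≈⟨ 0≡p ⟩
        p           ≡⟨ m∸n+n≡m (<⇒≤ r<p) ⟨
        p ∸ r + r   ∎
        where open ≡-mod-Reasoning p

    c+r≡p : c ≡ p ∸ r → c + r ≡ p
    c+r≡p c≡p∸r = trans (cong (_+ r) c≡p∸r) (m∸n+n≡m (<⇒≤ r<p))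

    b≤r : c ≡ p ∸ r → b ≤ r
    b≤r c≡p∸r = +-cancelˡ-≤ c b r (subst (c + b ≤_) (sym (c+r≡p c≡p∸r)) c+b≤p)

    α+r+[β∸r]≡p : r ≤ β → α + r + (β ∸ r) ≡ p
    α+r+[β∸r]≡p r≤β = trans (+-assoc α r (β ∸ r)) (trans (cong (α +_) (m+[n∸m]≡n r≤β)) α+β≡p)

    α+r≡p+[r∸β] : β ≤ r → α + r ≡ p + (r ∸ β)
    α+r≡p+[r∸β] β≤r = trans (cong (α +_) (sym (m+[n∸m]≡n β≤r))) (trans (sym (+-assoc α β (r ∸ β))) (cong (_+ (r ∸ β)) α+β≡p))

    top-b-low : 0 < r → r ≤ β → α + r + b ≡ 0 mod p → b ≡ β ∸ r
    top-b-low 0<r r≤β α+r+b≡0 = ≡-mod-<p⇒≡ b≡β∸r b<p β∸r<p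
      where
      β∸r<p : β ∸ r < p
      β∸r<p = <-≤-trans (m<m+n (β ∸ r) 0<r) (≤-trans (≤-reflexive (m∸n+n≡m r≤β)) (subst (β ≤_) α+β≡p (m≤n+m β α)))
      b≡β∸r : b ≡ β ∸ r mod p
      b≡β∸r = +-cancelʳ-≡-mod (α + r) (begin
        b + (α + r)       ≡⟨ +-comm b (α + r) ⟩
        α + r + b         ≈⟨ α+r+b≡0 ⟩
        0                 ≈⟨ 0≡p ⟩
        p                 ≡⟨ α+r+[β∸r]≡p r≤β ⟨
        α + r + (β ∸ r)   ≡⟨ +-comm (α + r) (β ∸ r) ⟩
        β ∸ r + (α + r)   ∎)
        where open ≡-mod-Reasoning p

    bottom-c-high : β < r → c ≡ α + r mod p → c ≡ r ∸ β
    bottom-c-high β<r c≡α+r = ≡-mod-≤p⇒≡ c≡r∸β 0<c c≤p (m<n⇒0<n∸m β<r) (≤-trans (m∸n≤m r β) (<⇒≤ r<p))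
      where
      c≡r∸β : c ≡ r ∸ β mod p
      c≡r∸β = begin
        c             ≈⟨ c≡α+r ⟩
        α + r         ≡⟨ α+r≡p+[r∸β] (<⇒≤ β<r) ⟩
        p + (r ∸ β)   ≡⟨ +-comm p (r ∸ β) ⟩
        r ∸ β + p     ≈⟨ m+p≡m-mod (r ∸ β) ⟩
        r ∸ β         ∎
        where open ≡-mod-Reasoning p

    top-b-high : β < r → α + r + b ≡ 0 mod p → b + (r ∸ β) ≡ p
    top-b-high β<r α+r+b≡0 = trans (cong (_+ t) b≡p∸t) (m∸n+n≡m t≤p)
      where
      t : ℕ
      t = r ∸ β
      t≤p : t ≤ p
      t≤p = ≤-trans (m∸n≤m r β) (<⇒≤ r<p)
      b+t≡p∸t+t : b + t ≡ p ∸ t + t mod p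
      b+t≡p∸t+t = begin
        b + t       ≈⟨ m+p≡m-mod (b + t) ⟨
        b + t + p   ≡⟨ solve 3 (λ b t p → b :+ t :+ p := p :+ t :+ b) refl b t p ⟩
        p + t + b   ≡⟨ cong (_+ b) (α+r≡p+[r∸β] (<⇒≤ β<r)) ⟨
        α + r + b   ≈⟨ α+r+b≡0 ⟩
        0           ≈⟨ 0≡p ⟩
        p           ≡⟨ m∸n+n≡m t≤p ⟨
        p ∸ t + t   ∎
        where open ≡-mod-Reasoning p
      b≡p∸t : b ≡ p ∸ t
      b≡p∸t = ≡-mod-<p⇒≡ (+-cancelʳ-≡-mod t b+t≡p∸t+t) b<p (∸-monoʳ-< (m<n⇒0<n∸m β<r) t≤p)

    bottom-b : b ≡ r mod p → b ≡ r
    bottom-b b≡r = ≡-mod-<p⇒≡ b≡r b<p r<p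

    half-pos : ∀ {n m} → n < m + m → 0 < m
    half-pos {m = suc m} _ = z<s

  case₁ : r + r ≤ β → CoreResidues p α r c b → rect c b ≡ rect (α + r) r
  case₁ r+r≤β (bottomAligned b≡r c≡α+r) = rect-cong (bottom-b b≡r) λ 0<b →
    ≡-mod-≤p⇒≡ c≡α+r 0<c c≤p (≤-trans (subst (0 <_) (bottom-b b≡r) 0<b) (m≤n+m r α))
               (≤-trans (+-monoʳ-≤ α (≤-trans (m≤m+n r r) r+r≤β)) (≤-reflexive α+β≡p))
  case₁ r+r≤β (topAligned c+r≡0 α+r+b≡0) = rect-cong b≡r (λ 0<b → c≡α+r (≤-trans 0<b (b≤r c≡p∸r)))
    where
    c≡p∸r : c ≡ p ∸ r
    c≡p∸r = top-c c+r≡0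
    r≤β : r ≤ β
    r≤β = ≤-trans (m≤m+n r r) r+r≤β
    b≡r : b ≡ r
    b≡r with m≤n⇒m<n∨m≡n (z≤n {r})
    ... | inj₁ 0<r = ≤-antisym (b≤r c≡p∸r) (subst (r ≤_) (sym (top-b-low 0<r r≤β α+r+b≡0)) (m+n≤o⇒m≤o∸n r r+r≤β))
    ... | inj₂ 0≡r = ≤-antisym (b≤r c≡p∸r) (subst (_≤ b) 0≡r z≤n)
    c≡α+r : 0 < r → c ≡ α + r
    c≡α+r 0<r = +-cancelʳ-≡ r c (α + r) (begin
      c + r              ≡⟨ c+r≡p c≡p∸r ⟩
      p                  ≡⟨ α+r+[β∸r]≡p r≤β ⟨
      α + r + (β ∸ r)    ≡⟨ cong (α + r +_) (trans (sym (top-b-low 0<r r≤β α+r+b≡0)) b≡r) ⟩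
      α + r + r          ∎)
      where open ≡-Reasoning

  case₂ : β < r + r → r ≤ β → CoreResidues p α r c b → rect c b ≡ rect (α + (β ∸ r)) (β ∸ r)
  case₂ β<r+r r≤β (bottomAligned b≡r c≡α+r-mod) = ⊥-elim (<⇒≱ p<c+b c+b≤p)
    where
    c≡α+r : c ≡ α + r
    c≡α+r = ≡-mod-≤p⇒≡ c≡α+r-mod 0<c c≤p (≤-trans (half-pos β<r+r) (m≤n+m r α))
                       (≤-trans (+-monoʳ-≤ α r≤β) (≤-reflexive α+β≡p))
    p<c+b : p < c + b
    p<c+b = begin-strict
      p              ≡⟨ α+β≡p ⟨
      α + β          <⟨ +-monoʳ-< α β<r+r ⟩
      α + (r + r)    ≡⟨ +-assoc α r r ⟨
      α + r + r      ≡⟨ cong₂ _+_ c≡α+r (bottom-b b≡r) ⟨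
      c + b          ∎
      where open ≤-Reasoning
  case₂ β<r+r r≤β (topAligned c+r≡0 α+r+b≡0) = cong₂ rect c≡ (top-b-low (half-pos β<r+r) r≤β α+r+b≡0)
    where
    c≡ : c ≡ α + (β ∸ r)
    c≡ = +-cancelʳ-≡ r c (α + (β ∸ r)) (begin
      c + r              ≡⟨ c+r≡p (top-c c+r≡0) ⟩
      p                  ≡⟨ α+r+[β∸r]≡p r≤β ⟨
      α + r + (β ∸ r)    ≡⟨ solve 3 (λ α r d → α :+ r :+ d := α :+ d :+ r) refl α r (β ∸ r) ⟩
      α + (β ∸ r) + r    ∎)
      where open ≡-Reasoning

  case₃ : β < r → r + r ≤ p + β → CoreResidues p α r c b → rect c b ≡ rect (r ∸ β) (β + (r ∸ β))
  case₃ β<r _ (bottomAligned b≡r c≡α+r) =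
    cong₂ rect (bottom-c-high β<r c≡α+r) (trans (bottom-b b≡r) (sym (m+[n∸m]≡n (<⇒≤ β<r))))
  case₃ β<r r+r≤p+β (topAligned c+r≡0 α+r+b≡0) = cong₂ rect c≡t (trans b≡c+β (trans (cong (_+ β) c≡t) (+-comm t β)))
    where
    t : ℕ
    t = r ∸ β
    r≡β+t : r ≡ β + t
    r≡β+t = sym (m+[n∸m]≡n (<⇒≤ β<r))
    c≡p∸r : c ≡ p ∸ r
    c≡p∸r = top-c c+r≡0
    b≡c+β : b ≡ c + β
    b≡c+β = +-cancelʳ-≡ t b (c + β) (begin
      b + t          ≡⟨ top-b-high β<r α+r+b≡0 ⟩
      p              ≡⟨ c+r≡p c≡p∸r ⟨
      c + r          ≡⟨ cong (c +_) r≡β+t ⟩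
      c + (β + t)    ≡⟨ +-assoc c β t ⟨
      c + β + t      ∎)
      where open ≡-Reasoning
    c≤t : c ≤ t
    c≤t = +-cancelˡ-≤ β c t (begin
      β + c    ≡⟨ +-comm β c ⟩
      c + β    ≡⟨ b≡c+β ⟨
      b        ≤⟨ b≤r c≡p∸r ⟩
      r        ≡⟨ r≡β+t ⟩
      β + t    ∎)
      where open ≤-Reasoning
    t≤c : t ≤ c
    t≤c = +-cancelˡ-≤ β t c (begin
      β + t    ≡⟨ r≡β+t ⟨
      r        ≤⟨ +-cancelʳ-≤ r r (c + β) (begin
                    r + r          ≤⟨ r+r≤p+β ⟩
                    p + β          ≡⟨ cong (_+ β) (c+r≡p c≡p∸r) ⟨
                    c + r + β      ≡⟨ solve 3 (λ c r β → c :+ r :+ β := c :+ β :+ r) refl c r β ⟩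
                    c + β + r      ∎) ⟩
      c + β    ≡⟨ +-comm c β ⟩
      β + c    ∎)
      where open ≤-Reasoning
    c≡t : c ≡ t
    c≡t = ≤-antisym c≤t t≤c

  case₄ : p + β < r + r → CoreResidues p α r c b → rect c b ≡ rect (p ∸ r) (β + (p ∸ r))
  case₄ p+β<r+r (bottomAligned b≡r c≡α+r) = ⊥-elim (<⇒≱ p<c+b c+b≤p)
    where
    β<r : β < r
    β<r = ≰⇒> (λ r≤β → <⇒≱ p+β<r+r (+-mono-≤ (<⇒≤ r<p) r≤β))
    p<c+b : p < c + b
    p<c+b = +-cancelˡ-< β p (c + b) (begin-strict
      β + p                ≡⟨ +-comm β p ⟩
      p + β                <⟨ p+β<r+r ⟩
      r + r                ≡⟨ cong (_+ r) (sym (m+[n∸m]≡n (<⇒≤ β<r))) ⟩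
      β + (r ∸ β) + r      ≡⟨ +-assoc β (r ∸ β) r ⟩
      β + ((r ∸ β) + r)    ≡⟨ cong₂ (λ x y → β + (x + y)) (bottom-c-high β<r c≡α+r) (bottom-b b≡r) ⟨
      β + (c + b)          ∎)
      where open ≤-Reasoning
  case₄ p+β<r+r (topAligned c+r≡0 α+r+b≡0) = cong₂ rect c≡p∸r b≡
    where
    β<r : β < r
    β<r = ≰⇒> (λ r≤β → <⇒≱ p+β<r+r (+-mono-≤ (<⇒≤ r<p) r≤β))
    c≡p∸r : c ≡ p ∸ r
    c≡p∸r = top-c c+r≡0
    t : ℕ
    t = r ∸ β
    b≡ : b ≡ β + (p ∸ r)
    b≡ = +-cancelʳ-≡ t b (β + (p ∸ r)) (begin
      b + t                  ≡⟨ top-b-high β<r α+r+b≡0 ⟩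
      p                      ≡⟨ m∸n+n≡m (<⇒≤ r<p) ⟨
      p ∸ r + r              ≡⟨ cong (p ∸ r +_) (sym (m+[n∸m]≡n (<⇒≤ β<r))) ⟩
      p ∸ r + (β + t)        ≡⟨ solve 3 (λ u β t → u :+ (β :+ t) := β :+ u :+ t) refl (p ∸ r) β t ⟩
      β + (p ∸ r) + t        ∎)
      where open ≡-Reasoning

2*m≡m+m : ∀ m → 2 * m ≡ m + m
2*m≡m+m m = cong (m +_) (+-identityʳ m)

theorem3p6 : (p : ℕ) → .{{_ : NonZero p}} → 2 ≤ p →
    (bs : Blocks) → IsJSBlocks p bs →
    (α : ℕ) → jsType p bs ≡ α →
    (r : ℕ) → r < p → length (toPartition bs) % p ≡ r % p →
    ((2 * r ≤ p ∸ α →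
        IsPCoreOf p (toPartition bs) (rect (α + r) r))
    × (p ∸ α < 2 * r → r ≤ p ∸ α →
        IsPCoreOf p (toPartition bs) (rect (α + ((p ∸ α) ∸ r)) ((p ∸ α) ∸ r)))
    × (p ∸ α < r → 2 * r ≤ 2 * p ∸ α →
        IsPCoreOf p (toPartition bs) (rect (r ∸ (p ∸ α)) ((p ∸ α) + (r ∸ (p ∸ α)))))
    × (2 * p ∸ α < 2 * r →
        IsPCoreOf p (toPartition bs) (rect (p ∸ r) ((p ∸ α) + (p ∸ r)))))
theorem3p6 p _ bs js α type≡α r r<p N≡r =
  let open Sliding p
      (c , b , core , 0<c , c+b≤p , residues) = pCoreOf-JS js type≡α (%≡%⇒≡-mod N≡r)
      α≤p : α ≤ p
      α≤p = <⇒≤ (subst (_< p) type≡α (jsType<p bs))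
      open Classification {α = α} {β = p ∸ α} (m+[n∸m]≡n α≤p) r<p 0<c c+b≤p
      core-is : ∀ {μ} → rect c b ≡ μ → IsPCoreOf p (toPartition bs) μ
      core-is rect≡μ = subst (IsPCoreOf p (toPartition bs)) rect≡μ core
      2p∸α≡ : 2 * p ∸ α ≡ p + (p ∸ α)
      2p∸α≡ = trans (cong (_∸ α) (2*m≡m+m p)) (+-∸-assoc p α≤p)
  in  (λ 2r≤β → core-is (case₁ (subst (_≤ p ∸ α) (2*m≡m+m r) 2r≤β) residues))
    , (λ β<2r r≤β → core-is (case₂ (subst (p ∸ α <_) (2*m≡m+m r) β<2r) r≤β residues))
    , (λ β<r 2r≤2p∸α → core-is (case₃ β<r (subst₂ _≤_ (2*m≡m+m r) 2p∸α≡ 2r≤2p∸α) residues))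
    , (λ 2p∸α<2r → core-is (case₄ (subst₂ _<_ 2p∸α≡ (2*m≡m+m r) 2p∸α<2r) residues))
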